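{- Let $t\ge 3$ be an odd integer, let $n$ be odd, and let $\mathcal D$ be an adjusted $t$-decomposition of $K_n$. Let $H$ be an undirected graph with $n$ vertices and maximum degree $d$. Then there are at most $11d^3t^4(n-1)!$ atypical labeled copies of $H$ in $K_n$.
   Context: Let $K_n$ have vertex set $[n]$. A decomposition of $K_n$ is a family $\mathcal D$ of pairwise edge-disjoint subgraphs covering all edges. For odd $t\ge3$ and odd $n$, $\mathcal D$ is an adjusted $t$-decomposition if the edges of all elements of $\mathcal D$ that are not isomorphic to $K_t$ form a graph $B$ on $n$ vertices of maximum degree at most $3t-5$, and the elements of $\mathcal D$ decomposing $B$ consist of at most $n(t-3)/6$ triangles, at most $t-3$ cycles of length $4$, and at most $t-1$ copies of $K_{2t-1}$. A labeled copy of $H$ in $K_n$ is determined by a bijection $\sigma:V(H)\to[n]$ (there are $n!$ of them), the copy having edge set $\{\sigma(u)\sigma(v): uv\in E(H)\}$. Let $\mathcal D'$ be the elements of $\mathcal D$ not isomorphic to $K_t$. A labeled copy of $H$ is atypical if (i) some element of $\mathcal D'$ contains two or more edges of the copy, or (ii) some $K_t$ element of $\mathcal D$ contains three or more edges of the copy where these three edges do not form a triangle in the copy. -}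

module Defs where

open import Data.Nat using (ℕ; zero; suc; _+_; _*_; _≤_)
open import Data.Bool using (Bool; true; false; if_then_else_)
open import Data.Fin using (Fin)
open import Data.Vec using (Vec; lookup)
open import Data.List using (List; length)
open import Data.List.Relation.Unary.All using (All)
open import Data.List.Relation.Unary.Unique.Propositional using (Unique)
open import Data.Product using (Σ; ∃; _×_; _,_)
open import Data.Sum using (_⊎_)
open import Relation.Nullary using (¬_)
open import Relation.Binary.PropositionalEquality using (_≡_; _≢_)
open import Function.Bundles using (_⇔_)

Odd : ℕ → Set
Odd k = ∃ λ j → k ≡ suc (2 * j)

-- "at most k elements of A satisfy P": every duplicate-free list of
-- elements satisfying P has length ≤ k  (the cardinality of {x | P x} is ≤ k)
AtMost : {A : Set} → ℕ → (A → Set) → Set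
AtMost {A} k P = (xs : List A) → Unique xs → All P xs → length xs ≤ k

-- a (spanning) graph / edge set on vertex set Fin n, as an adjacency function
Graph : ℕ → Set
Graph n = Fin n → Fin n → Bool

IsSimple : {n : ℕ} → Graph n → Set
IsSimple {n} G = ((u v : Fin n) → G u v ≡ G v u) × ((u : Fin n) → G u u ≡ false)

countᵇ : {n : ℕ} → (Fin n → Bool) → ℕ
countᵇ {zero} f = 0
countᵇ {suc n} f = (if f Fin.zero then 1 else 0) + countᵇ {n} (λ i → f (Fin.suc i))

degree : {n : ℕ} → Graph n → Fin n → ℕ
degree G v = countᵇ (G v)

MaxDegree : {n : ℕ} → Graph n → ℕ → Set
MaxDegree {n} G d = ((v : Fin n) → degree G v ≤ d) × (∃ λ v → degree G v ≡ d)

SameEdge : {n : ℕ} → Fin n → Fin n → Fin n → Fin n → Set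
SameEdge u v x y = (u ≡ x × v ≡ y) ⊎ (u ≡ y × v ≡ x)

IsDecomposition : {n m : ℕ} → (Fin m → Graph n) → Set
IsDecomposition {n} {m} D =
  ((i : Fin m) → IsSimple (D i)) ×
  ((i j : Fin m) (u v : Fin n) → i ≢ j → D i u v ≡ true → D j u v ≡ false) ×
  ((u v : Fin n) → u ≢ v → ∃ λ i → D i u v ≡ true)

-- the subgraph formed by the edges of G is isomorphic to K_k:
-- its edges are exactly the pairs inside some k-set S
IsComplete : {n : ℕ} → ℕ → Graph n → Set
IsComplete {n} k G = Σ (Fin n → Bool) λ S → countᵇ S ≡ k ×
  ((u v : Fin n) → (G u v ≡ true) ⇔ (u ≢ v × S u ≡ true × S v ≡ true))

IsC4 : {n : ℕ} → Graph n → Set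
IsC4 {n} G = Σ (Fin n) λ a → Σ (Fin n) λ b → Σ (Fin n) λ c → Σ (Fin n) λ d →
  (a ≢ b × a ≢ c × a ≢ d × b ≢ c × b ≢ d × c ≢ d) ×
  ((u v : Fin n) → (G u v ≡ true) ⇔
     (SameEdge u v a b ⊎ SameEdge u v b c ⊎ SameEdge u v c d ⊎ SameEdge u v d a))

IsAdjusted : {n m : ℕ} → ℕ → (Fin m → Graph n) → Set
IsAdjusted {n} {m} t D =
  IsDecomposition D ×
  ((v : Fin n) → AtMost (3 * t Data.Nat.∸ 5)
       (λ w → Σ (Fin m) λ i → ¬ IsComplete t (D i) × D i v w ≡ true)) ×
  ((i : Fin m) → ¬ IsComplete t (D i) →
       IsComplete 3 (D i) ⊎ IsC4 (D i) ⊎ IsComplete (2 * t Data.Nat.∸ 1) (D i)) ×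
  AtMost ((n * (t Data.Nat.∸ 3)) Data.Nat./ 6)
       (λ i → ¬ IsComplete t (D i) × IsComplete 3 (D i)) ×
  AtMost (t Data.Nat.∸ 3) (λ i → ¬ IsComplete t (D i) × IsC4 (D i)) ×
  AtMost (t Data.Nat.∸ 1)
       (λ i → ¬ IsComplete t (D i) × IsComplete (2 * t Data.Nat.∸ 1) (D i))

-- labeled copies: bijections σ : V(H) = Fin n → [n] = Fin n, stored as vectors
IsBijection : {n : ℕ} → Vec (Fin n) n → Set
IsBijection {n} σ =
  ((u v : Fin n) → lookup σ u ≡ lookup σ v → u ≡ v) ×
  ((a : Fin n) → ∃ λ u → lookup σ u ≡ a)

CopyEdge : {n : ℕ} → Graph n → Vec (Fin n) n → Fin n → Fin n → Set
CopyEdge {n} H σ a b = Σ (Fin n) λ u → Σ (Fin n) λ v →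
  H u v ≡ true × lookup σ u ≡ a × lookup σ v ≡ b

FormTriangle : {n : ℕ} → Fin n → Fin n → Fin n → Fin n → Fin n → Fin n → Set
FormTriangle {n} a1 b1 a2 b2 a3 b3 = Σ (Fin n) λ x → Σ (Fin n) λ y → Σ (Fin n) λ z →
  x ≢ y × y ≢ z × x ≢ z ×
  SameEdge a1 b1 x y × SameEdge a2 b2 y z × SameEdge a3 b3 z x

Atypical : {n m : ℕ} → ℕ → (Fin m → Graph n) → Graph n → Vec (Fin n) n → Set
Atypical {n} {m} t D H σ =
  (Σ (Fin m) λ i → ¬ IsComplete t (D i) ×
     (Σ (Fin n) λ a → Σ (Fin n) λ b → Σ (Fin n) λ a' → Σ (Fin n) λ b' →
        CopyEdge H σ a b × CopyEdge H σ a' b' × ¬ SameEdge a b a' b' ×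
        D i a b ≡ true × D i a' b' ≡ true))
  ⊎
  (Σ (Fin m) λ i → IsComplete t (D i) ×
     (Σ (Fin n) λ a1 → Σ (Fin n) λ b1 → Σ (Fin n) λ a2 → Σ (Fin n) λ b2 →
      Σ (Fin n) λ a3 → Σ (Fin n) λ b3 →
        CopyEdge H σ a1 b1 × CopyEdge H σ a2 b2 × CopyEdge H σ a3 b3 ×
        D i a1 b1 ≡ true × D i a2 b2 ≡ true × D i a3 b3 ≡ true ×
        ¬ SameEdge a1 b1 a2 b2 × ¬ SameEdge a1 b1 a3 b3 × ¬ SameEdge a2 b2 a3 b3 ×
        ¬ FormTriangle a1 b1 a2 b2 a3 b3))

module Submission where

open import Defs
open import Data.Nat using (ℕ; _*_; _^_; _∸_; _≤_; _!)
open import Data.Fin using (Fin)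
open import Data.Vec using (Vec)
open import Data.Product using (_×_)

open import Data.Nat using (zero; suc; _+_; _<_; z≤n; s≤s; _≤?_; _<?_)
open import Data.Nat.Properties
open import Data.Nat.Solver using (module +-*-Solver)
open +-*-Solver using (solve; _:+_; _:*_; _:^_; _:=_; con)
open import Data.Bool using (Bool; true; false; if_then_else_)
open import Data.Fin using () renaming (zero to fzero; suc to fsuc; _≟_ to _≟F_)
open import Data.Fin.Properties using () renaming (0≢1+n to fzero≢fsuc; suc-injective to fsuc-injective)
open import Data.Maybe using (Maybe; just; nothing)
open import Data.Vec using (lookup; head; tail) renaming (_∷_ to _∷ᵥ_; [] to []ᵥ)
open import Data.List using (List; []; _∷_; length; map; _++_)
open import Data.List.Properties using (length-map; length-++)
open import Data.List.Relation.Unary.All as All using (All; []; _∷_; reduce)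
open import Data.List.Relation.Unary.All.Properties using (¬Any⇒All¬)
open import Data.List.Relation.Unary.Any using (here; there)
open import Data.List.Relation.Unary.AllPairs using ([]; _∷_)
open import Data.List.Relation.Unary.Unique.Propositional using (Unique)
import Data.List.Relation.Unary.Unique.Propositional.Properties as Unique
open import Data.List.Membership.Propositional using (_∈_; _∉_)
open import Data.List.Membership.Propositional.Properties using (∈-map⁻)
import Data.List.Membership.DecPropositional as DecMembership
open import Data.Product using (Σ; _,_; proj₁; proj₂)
import Data.Product.Properties as Product
open import Data.Sum using (_⊎_; inj₁; inj₂; map₂)
open import Data.Empty using (⊥; ⊥-elim)
open import Data.Unit using (⊤; tt)
import Data.Unit.Properties as Unit
open import Relation.Nullary using (¬_; yes; no)
open import Relation.Nullary.Decidable using (True; toWitness)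
open import Relation.Binary.PropositionalEquality
open import Relation.Binary.Definitions using (DecidableEquality)
open import Function using (_∘_)
open import Function.Bundles using (Equivalence)

-- A "configuration type" is a set of admissible tuples of vertices, each
-- prescribing the images of j vertices of H; it is realised by at most
-- (#tuples)·(n ∸ j)! bijections.
--
-- An atypical copy σ realises one of five configuration types.  In case (i)
-- the two edges in a non-K_t element D i either share a vertex (a cherry of H
-- on two edges of the graph B) or not (two edges of H inside one sparse
-- element).  In case (ii) the three edges in a K_t either contain a cherry,
-- and the third edge adds one or two vertices, or form a matching.  A type
-- pinning j vertices has at most c · n^(j∸1) placements: all but j ∸ 1 of the
-- vertices range over bounded neighbourhoods (H-degree ≤ d, B-degree ≤ 3t ∸ 5,
-- sparse elements of order ≤ 2t ∸ 1, K_t elements of order t).  This gives at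
-- most Σ c · n^(j∸1) (n ∸ j)! atypical copies with Σ c ≤ 8 d³t⁴.  If
-- n > 11 d³t⁴ then n ≥ 165 and each n^(j∸1)(n ∸ j)! ≤ (11/10)(n ∸ 1)!;
-- otherwise the trivial bound n! ≤ 11 d³t⁴ (n ∸ 1)! applies.

module _ {A : Set} where

  atMost-mono : {P Q : A → Set} {k k′ : ℕ} → AtMost k Q → (∀ {x} → P x → Q x) → k ≤ k′ → AtMost k′ P
  atMost-mono hQ PQ k≤k′ xs u ps = ≤-trans (hQ xs u (All.map PQ ps)) k≤k′

  atMost-≤ : {P : A → Set} {k k′ : ℕ} → k ≤ k′ → AtMost k P → AtMost k′ P
  atMost-≤ k≤k′ hP xs u ps = ≤-trans (hP xs u ps) k≤k′

  atMost-none : {P : A → Set} → (∀ {x} → ¬ P x) → AtMost 0 P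
  atMost-none ¬P []      _ _        = z≤n
  atMost-none ¬P (_ ∷ _) _ (p ∷ _) = ⊥-elim (¬P p)

  atMost-single : (a : A) → AtMost 1 (_≡ a)
  atMost-single a []               _                _                 = z≤n
  atMost-single a (_ ∷ [])         _                _                 = s≤s z≤n
  atMost-single a (_ ∷ _ ∷ _) ((x≢y ∷ _) ∷ _) (refl ∷ refl ∷ _) = ⊥-elim (x≢y refl)

  atMost-inhabited : {P : A → Set} {k : ℕ} → (∀ {x} → P x → AtMost k P) → AtMost k P
  atMost-inhabited h []       _ _          = z≤n
  atMost-inhabited h (x ∷ xs) u (p ∷ ps) = h p (x ∷ xs) u (p ∷ ps)

  atMost-remove : {P : A → Set} {k : ℕ} {a : A} → AtMost (suc k) P → P a →
                  AtMost k (λ x → P x × x ≢ a)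
  atMost-remove {a = a} h pa xs u ps =
    ≤-pred (h (a ∷ xs) (All.map (λ (_ , x≢a) a≡x → x≢a (sym a≡x)) ps ∷ u) (pa ∷ All.map proj₁ ps))

  atMost-0⇒¬ : {P : A → Set} {a : A} → AtMost 0 P → ¬ P a
  atMost-0⇒¬ {a = a} h p with () ← h (a ∷ []) ([] ∷ []) (p ∷ [])

  -- Bounds add up over a disjunction: peel off the first listed element and
  -- remove it from whichever side it satisfies.
  atMost-⊎ : {P Q : A → Set} {k₁ k₂ : ℕ} → AtMost k₁ P → AtMost k₂ Q →
             AtMost (k₁ + k₂) (λ x → P x ⊎ Q x)
  atMost-⊎ hP hQ [] _ _ = z≤n
  atMost-⊎ {k₁ = zero} hP hQ (_ ∷ _) _ (inj₁ p ∷ _) = ⊥-elim (atMost-0⇒¬ hP p)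
  atMost-⊎ {P} {Q} {k₁ = suc k₁} hP hQ (x ∷ xs) (x∉xs ∷ u) (inj₁ p ∷ ps) =
    s≤s (atMost-⊎ (atMost-remove hP p) hQ xs u (All.zipWith tag (x∉xs , ps)))
    where tag : ∀ {y} → x ≢ y × (P y ⊎ Q y) → (P y × y ≢ x) ⊎ Q y
          tag (x≢y , inj₁ py) = inj₁ (py , λ y≡x → x≢y (sym y≡x))
          tag (_   , inj₂ qy) = inj₂ qy
  atMost-⊎ {k₂ = zero} hP hQ (_ ∷ _) _ (inj₂ q ∷ _) = ⊥-elim (atMost-0⇒¬ hQ q)
  atMost-⊎ {P} {Q} {k₁} {suc k₂} hP hQ (x ∷ xs) (x∉xs ∷ u) (inj₂ q ∷ ps) =
    subst (suc (length xs) ≤_) (sym (+-suc k₁ k₂))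
      (s≤s (atMost-⊎ hP (atMost-remove hQ q) xs u (All.zipWith tag (x∉xs , ps))))
    where tag : ∀ {y} → x ≢ y × (P y ⊎ Q y) → P y ⊎ (Q y × y ≢ x)
          tag (_   , inj₁ py) = inj₁ py
          tag (x≢y , inj₂ qy) = inj₂ (qy , λ y≡x → x≢y (sym y≡x))

  atMost-∈ : (L : List A) → AtMost (length L) (_∈ L)
  atMost-∈ []      = atMost-none (λ ())
  atMost-∈ (a ∷ L) = atMost-mono (atMost-⊎ (atMost-single a) (atMost-∈ L)) member ≤-refl
    where member : ∀ {x} → x ∈ a ∷ L → x ≡ a ⊎ x ∈ L
          member (here x≡a)  = inj₁ x≡a
          member (there x∈L) = inj₂ x∈L

module _ {X Y : Set} where

  atMost-embed : {Q : X → Set} {T : Y → Set} {k : ℕ}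
                 (f : ∀ {x} → Q x → Y) (g : Y → X) → (∀ {x} (q : Q x) → g (f q) ≡ x) →
                 (∀ {x} (q : Q x) → T (f q)) → AtMost k T → AtMost k Q
  atMost-embed {Q} {T} {k} f g g∘f fT hT xs u qs =
    subst (_≤ k) (trans (sym (length-map g ys)) (cong length readBack))
      (hT ys (Unique.map⁻ (subst Unique (sym readBack) u)) (images qs))
    where
      ys : List Y
      ys = reduce f qs
      readBack′ : ∀ {zs} (rs : All Q zs) → map g (reduce f rs) ≡ zs
      readBack′ []       = refl
      readBack′ (r ∷ rs) = cong₂ _∷_ (g∘f r) (readBack′ rs)
      readBack : map g ys ≡ xs
      readBack = readBack′ qs
      images : ∀ {zs} (rs : All Q zs) → All T (reduce f rs)
      images []       = []
      images (r ∷ rs) = fT r ∷ images rs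

module _ {A B : Set} (_≟_ : DecidableEquality A) where

  atMost-Σ : {P : A → Set} {Q : A → B → Set} {k₁ k₂ : ℕ} →
             AtMost k₁ P → (∀ a → P a → AtMost k₂ (Q a)) →
             AtMost (k₁ * k₂) (λ p → P (proj₁ p) × Q (proj₁ p) (proj₂ p))
  atMost-Σ {k₁ = zero} hP hQ = atMost-none (λ (pa , _) → atMost-0⇒¬ hP pa)
  atMost-Σ {P} {Q} {k₁ = suc k₁} {k₂} hP hQ = atMost-inhabited λ {(a , _)} (pa , _) →
    atMost-mono (atMost-⊎ (fibre a pa) (atMost-Σ (atMost-remove hP pa) (λ x (px , _) → hQ x px)))
                (classify a) ≤-refl
    where
      fibre : ∀ a → P a → AtMost k₂ (λ p → proj₁ p ≡ a × Q (proj₁ p) (proj₂ p))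
      fibre a pa = atMost-embed (λ {p} _ → proj₂ p) (a ,_) (λ { (refl , _) → refl }) (λ { (refl , q) → q }) (hQ a pa)
      classify : ∀ a {p} → P (proj₁ p) × Q (proj₁ p) (proj₂ p) →
                 (proj₁ p ≡ a × Q (proj₁ p) (proj₂ p)) ⊎ ((P (proj₁ p) × proj₁ p ≢ a) × Q (proj₁ p) (proj₂ p))
      classify a {x , _} (px , q) with x ≟ a
      ... | yes x≡a = inj₁ (x≡a , q)
      ... | no  x≢a = inj₂ ((px , x≢a) , q)

atMost-if : {A : Set} (b : Bool) (a : A) → AtMost (if b then 1 else 0) (λ x → x ≡ a × b ≡ true)
atMost-if true  a = atMost-mono (atMost-single a) proj₁ ≤-refl
atMost-if false a = atMost-none (λ { (_ , ()) })

atMost-countᵇ : {n : ℕ} (f : Fin n → Bool) → AtMost (countᵇ f) (λ x → f x ≡ true)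
atMost-countᵇ {zero}  f = atMost-none (λ { {()} })
atMost-countᵇ {suc n} f =
  atMost-mono (atMost-⊎ (atMost-if (f fzero) fzero)
                        (atMost-embed proj₁ fsuc (λ (_ , x≡si , _) → sym x≡si) (λ (_ , _ , fi) → fi)
                                      (atMost-countᵇ (λ i → f (fsuc i)))))
              split ≤-refl
  where
    split : ∀ {x} → f x ≡ true → (x ≡ fzero × f fzero ≡ true) ⊎ Σ (Fin n) λ i → x ≡ fsuc i × f (fsuc i) ≡ true
    split {fzero}  fx = inj₁ (refl , fx)
    split {fsuc i} fx = inj₂ (i , refl , fx)

atMost-Fin : (n : ℕ) → AtMost n (λ (_ : Fin n) → ⊤)
atMost-Fin n = atMost-mono (atMost-countᵇ (λ _ → true)) (λ _ → refl) (≤-reflexive (countAll n))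
  where countAll : ∀ n → countᵇ {n} (λ _ → true) ≡ n
        countAll zero    = refl
        countAll (suc n) = cong suc (countAll n)

atMost-Fin× : {B : Set} {n k : ℕ} {Q : Fin n → B → Set} → (∀ a → AtMost k (Q a)) →
              AtMost (n * k) (λ p → Q (proj₁ p) (proj₂ p))
atMost-Fin× {n = n} hQ = atMost-mono (atMost-Σ _≟F_ (atMost-Fin n) (λ a _ → hQ a)) (λ q → tt , q) ≤-refl

∸-suc : ∀ n k → k < n → n ∸ k ≡ suc (n ∸ suc k)
∸-suc (suc n) zero    _         = refl
∸-suc (suc n) (suc k) (s≤s k<n) = ∸-suc n k k<n

factorial-step : ∀ n k → k < n → (n ∸ k) ! ≡ (n ∸ k) * (n ∸ suc k) !
factorial-step n k k<n rewrite ∸-suc n k k<n = refl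

-- Peeling one factor off (n ∸ k)! never increases it (both sides vanish when n ≤ k).
factorial-peel : ∀ n k → (n ∸ k) * (n ∸ suc k) ! ≤ (n ∸ k) !
factorial-peel n k with k <? n
... | yes k<n = ≤-reflexive (sym (factorial-step n k k<n))
... | no  k≮n rewrite m≤n⇒m∸n≡0 (≮⇒≥ k≮n) = z≤n

atMost-avoiding : {n : ℕ} (X : List (Fin n)) → Unique X → AtMost (n ∸ length X) (_∉ X)
atMost-avoiding {n} X uX ys uys ys∉X =
  m+n≤o⇒m≤o∸n (length ys)
    (subst (_≤ n) (length-++ ys)
      (atMost-Fin n (ys ++ X) (Unique.++⁺ uys uX (λ (y∈ys , y∈X) → All.lookup ys∉X y∈ys y∈X))
                    (All.universal _ _)))

-- Pins for vectors of length m: some coordinates get a prescribed value.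
Pins : ℕ → ℕ → Set
Pins m n = Fin m → Maybe (Fin n)

-- v is injective, takes the prescribed values, and its unpinned
-- coordinates avoid the list X (in use: the prescribed values).
Respects : {m n : ℕ} → Pins m n → List (Fin n) → Vec (Fin n) m → Set
Respects {m} {n} p X v =
  ((u w : Fin m) → lookup v u ≡ lookup v w → u ≡ w) ×
  ((u : Fin m) (y : Fin n) → p u ≡ just y → lookup v u ≡ y) ×
  ((u : Fin m) → p u ≡ nothing → lookup v u ∉ X)

-- The tail of a respecting vector respects the shifted pins; its free
-- coordinates also avoid the head, by injectivity.
respects-tail : {m n : ℕ} {p : Pins (suc m) n} {X : List (Fin n)} {h : Fin n} {t : Vec (Fin n) m} →
                Respects p X (h ∷ᵥ t) → Respects (p ∘ fsuc) X t
respects-tail (inj , fits , avoid) =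
  (λ u w e → fsuc-injective (inj (fsuc u) (fsuc w) e)) , (λ u → fits (fsuc u)) , (λ u → avoid (fsuc u))

respects-tail-free : {m n : ℕ} {p : Pins (suc m) n} {X : List (Fin n)} {h : Fin n} {t : Vec (Fin n) m} →
                     Respects p X (h ∷ᵥ t) → Respects (p ∘ fsuc) (h ∷ X) t
respects-tail-free {h = h} {t} r@(inj , _) with (inj′ , fits , avoid) ← respects-tail r =
  inj′ , fits , λ u free → λ { (here t[u]≡h) → fzero≢fsuc (inj fzero (fsuc u) (sym t[u]≡h)) ; (there u∈X) → avoid u free u∈X }

unconsᵥ : {A : Set} {m : ℕ} → Vec A (suc m) → A × Vec A m
unconsᵥ v = head v , tail v

consᵥ : {A : Set} {m : ℕ} → A × Vec A m → Vec A (suc m)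
consᵥ (h , t) = h ∷ᵥ t

-- Counting respecting vectors: the head has one value when pinned and at
-- most n ∸ |X| values when free (in which case it joins X for the tail),
-- so the count is at most (n ∸ |X|)(n ∸ |X| ∸ 1)⋯ ≤ (n ∸ |X|)!.
atMost-respecting : {n : ℕ} (m : ℕ) (p : Pins m n) (X : List (Fin n)) → Unique X →
                    AtMost ((n ∸ length X) !) (Respects p X)
atMost-respecting {n} zero p X uX =
  atMost-≤ (1≤n! (n ∸ length X)) (atMost-embed (λ _ → tt) (λ _ → []ᵥ) (λ { {[]ᵥ} _ → refl }) (λ _ → refl) (atMost-single tt))
atMost-respecting {n} (suc m) p X uX with p fzero in p₀
... | just c =
  atMost-embed (λ {v} _ → unconsᵥ v) consᵥ (λ { {_ ∷ᵥ _} _ → refl }) (λ {v} → headPinned {v})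
    (atMost-≤ (≤-reflexive (+-identityʳ _))
      (atMost-Σ _≟F_ (atMost-single c) (λ _ _ → atMost-respecting m (p ∘ fsuc) X uX)))
  where
    headPinned : ∀ {v} → Respects p X v → head v ≡ c × Respects (p ∘ fsuc) X (tail v)
    headPinned {_ ∷ᵥ _} r@(_ , fits , _) = fits fzero c p₀ , respects-tail r
... | nothing =
  atMost-embed (λ {v} _ → unconsᵥ v) consᵥ (λ { {_ ∷ᵥ _} _ → refl }) (λ {v} → headFree {v})
    (atMost-≤ (factorial-peel n (length X))
      (atMost-Σ _≟F_ (atMost-avoiding X uX)
        (λ h h∉X → atMost-respecting m (p ∘ fsuc) (h ∷ X) (¬Any⇒All¬ X h∉X ∷ uX))))
  where
    headFree : ∀ {v} → Respects p X v → head v ∉ X × Respects (p ∘ fsuc) (head v ∷ X) (tail v)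
    headFree {_ ∷ᵥ _} r@(_ , _ , avoid) = avoid fzero p₀ , respects-tail-free r

Fix : {n : ℕ} → List (Fin n × Fin n) → Vec (Fin n) n → Set
Fix cs σ = All (λ (u , a) → lookup σ u ≡ a) cs

pinOf : {n : ℕ} → List (Fin n × Fin n) → Pins n n
pinOf []             u = nothing
pinOf ((x , y) ∷ cs) u with u ≟F x
... | yes _ = just y
... | no  _ = pinOf cs u

pinOf-just : {n : ℕ} (cs : List (Fin n × Fin n)) {u y : Fin n} → pinOf cs u ≡ just y → (u , y) ∈ cs
pinOf-just ((x , _) ∷ cs) {u} e with u ≟F x
pinOf-just ((x , _) ∷ cs) refl | yes refl = here refl
... | no _ = there (pinOf-just cs e)

pinOf-nothing : {n : ℕ} (cs : List (Fin n × Fin n)) {u : Fin n} → pinOf cs u ≡ nothing →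
                ∀ {c} → c ∈ cs → proj₁ c ≢ u
pinOf-nothing ((x , _) ∷ cs) {u} e c∈cs with u ≟F x
pinOf-nothing ((x , _) ∷ cs) () _ | yes _
pinOf-nothing ((x , _) ∷ cs) e (here refl) | no u≢x = λ x≡u → u≢x (sym x≡u)
pinOf-nothing ((x , _) ∷ cs) e (there c∈cs) | no _ = pinOf-nothing cs e c∈cs

atMost-bijections-fixing : {n : ℕ} (cs : List (Fin n × Fin n)) → Unique (map proj₂ cs) →
                           AtMost ((n ∸ length cs) !) (λ σ → IsBijection σ × Fix cs σ)
atMost-bijections-fixing {n} cs u =
  subst (λ k → AtMost ((n ∸ k) !) (λ σ → IsBijection σ × Fix cs σ)) (length-map proj₂ cs)
    (atMost-mono (atMost-respecting n (pinOf cs) (map proj₂ cs) u) (λ {σ} → respects {σ}) ≤-refl)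
  where
    respects : ∀ {σ} → IsBijection σ × Fix cs σ → Respects (pinOf cs) (map proj₂ cs) σ
    respects {σ} ((inj , _) , fix) =
      inj ,
      (λ v y e → All.lookup fix (pinOf-just cs e)) ,
      (λ v e σv∈ → let (c , c∈cs , σv≡) = ∈-map⁻ proj₂ σv∈ in
        pinOf-nothing cs e c∈cs (inj (proj₁ c) v (trans (All.lookup fix c∈cs) (sym σv≡))))

Vertices : ℕ → ℕ → Set
Vertices n zero          = ⊤
Vertices n (suc zero)    = Fin n
Vertices n (suc (suc k)) = Fin n × Vertices n (suc k)

_≟V_ : {n k : ℕ} → DecidableEquality (Vertices n k)
_≟V_ {k = zero}        = Unit._≟_
_≟V_ {k = suc zero}    = _≟F_
_≟V_ {k = suc (suc k)} = Product.≡-dec _≟F_ _≟V_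

-- A configuration type is a predicate Shape on vertex tuples w together with
-- the pins (u , a) that place vertices u of H onto vertices a of K_n.
-- σ realises it if some admissible w with distinct targets has all its pins fixed by σ.
Realises : {n k : ℕ} → (Vertices n k → Set) → (Vertices n k → List (Fin n × Fin n)) → Vec (Fin n) n → Set
Realises {n} {k} Shape pins σ =
  Σ (Vertices n k) λ w → Shape w × Unique (map proj₂ (pins w)) × IsBijection σ × Fix (pins w) σ

atMost-realising : {n k K : ℕ} (j : ℕ) {Shape : Vertices n k → Set} {pins : Vertices n k → List (Fin n × Fin n)} →
                   (∀ w → length (pins w) ≡ j) → AtMost K Shape → AtMost (K * (n ∸ j) !) (Realises Shape pins)
atMost-realising {n} j {Shape} {pins} length≡ hShape =
  atMost-embed (λ {σ} (w , _) → w , σ) proj₂ (λ _ → refl) (λ (_ , s , u , fixed) → (s , u) , fixed)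
    (atMost-Σ _≟V_ (atMost-mono hShape proj₁ ≤-refl) fixing)
  where
    fixing : ∀ w → Shape w × Unique (map proj₂ (pins w)) → AtMost ((n ∸ j) !) (λ σ → IsBijection σ × Fix (pins w) σ)
    fixing w (_ , u) = subst (λ l → AtMost ((n ∸ l) !) _) (length≡ w) (atMost-bijections-fixing (pins w) u)

falling : ℕ → ℕ → ℕ
falling n zero    = 1
falling n (suc j) = falling n j * (n ∸ suc j)

triangular : ℕ → ℕ
triangular zero    = 0
triangular (suc j) = triangular j + suc j

factorial-split : ∀ n j → suc j ≤ n → (n ∸ 1) ! ≡ falling n j * (n ∸ suc j) !
factorial-split n zero    _      = sym (+-identityʳ _)
factorial-split n (suc j) j+2≤n = begin
  (n ∸ 1) !                                             ≡⟨ factorial-split n j (≤-trans (n≤1+n _) j+2≤n) ⟩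
  falling n j * (n ∸ suc j) !                           ≡⟨ cong (falling n j *_) (factorial-step n (suc j) j+2≤n) ⟩
  falling n j * ((n ∸ suc j) * (n ∸ suc (suc j)) !)     ≡⟨ *-assoc (falling n j) _ _ ⟨
  falling n (suc j) * (n ∸ suc (suc j)) !               ∎
  where open ≡-Reasoning

-- n(n ∸ (a + b)) ≤ (n ∸ a)(n ∸ b): with n = a + b + c this reads
-- (a+b+c)c ≤ (b+c)(a+c) = (a+b+c)c + ab.
product-lower : ∀ n a b → n * (n ∸ (a + b)) ≤ (n ∸ a) * (n ∸ b)
product-lower n a b with ≤-total (a + b) n
... | inj₂ n≤a+b = subst (_≤ (n ∸ a) * (n ∸ b)) (sym (trans (cong (n *_) (m≤n⇒m∸n≡0 n≤a+b)) (*-zeroʳ n))) z≤n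
... | inj₁ a+b≤n = subst₂ _≤_ (sym lhs) (sym rhs) (m≤m+n _ _)
  where
    c : ℕ
    c = n ∸ (a + b)
    n≡ : n ≡ a + b + c
    n≡ = sym (m+[n∸m]≡n a+b≤n)
    n∸a≡ : n ∸ a ≡ b + c
    n∸a≡ = trans (cong (_∸ a) (trans n≡ (+-assoc a b c))) (m+n∸m≡n a (b + c))
    n∸b≡ : n ∸ b ≡ a + c
    n∸b≡ = trans (cong (_∸ b) (trans n≡ (trans (cong (_+ c) (+-comm a b)) (+-assoc b a c)))) (m+n∸m≡n b (a + c))
    lhs : n * c ≡ (a + b + c) * c
    lhs = cong (_* c) n≡
    rhs : (n ∸ a) * (n ∸ b) ≡ (a + b + c) * c + a * b
    rhs = trans (cong₂ _*_ n∸a≡ n∸b≡)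
                (solve 3 (λ a b c → (b :+ c) :* (a :+ c) := (a :+ b :+ c) :* c :+ a :* b) refl a b c)

power-falling : ∀ n j → n ^ j * (n ∸ triangular j) ≤ n * falling n j
power-falling n zero    = ≤-reflexive (trans (+-identityʳ n) (sym (*-identityʳ n)))
power-falling n (suc j) = begin
  n * n ^ j * (n ∸ (triangular j + suc j))   ≡⟨ solve 3 (λ n p c → n :* p :* c := p :* (n :* c)) refl n (n ^ j) _ ⟩
  n ^ j * (n * (n ∸ (triangular j + suc j))) ≤⟨ *-monoʳ-≤ (n ^ j) (product-lower n (triangular j) (suc j)) ⟩
  n ^ j * ((n ∸ triangular j) * (n ∸ suc j)) ≡⟨ *-assoc (n ^ j) _ _ ⟨
  n ^ j * (n ∸ triangular j) * (n ∸ suc j)   ≤⟨ *-monoˡ-≤ (n ∸ suc j) (power-falling n j) ⟩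
  n * falling n j * (n ∸ suc j)              ≡⟨ *-assoc n _ _ ⟩
  n * falling n (suc j)                      ∎
  where open ≤-Reasoning

-- n^j (n ∸ 1 ∸ j)!: a configuration with j + 1 prescribed vertices, one of
-- them placed freely, contributes at most this many bijections per unit.
pinnedCount : ℕ → ℕ → ℕ
pinnedCount n j = n ^ j * (n ∸ suc j) !

power-factorial : ∀ n j → 11 * triangular j ≤ n → suc j ≤ n → 10 * pinnedCount n j ≤ 11 * (n ∸ 1) !
power-factorial n@(suc _) j 11T≤n j<n = begin
  10 * (n ^ j * (n ∸ suc j) !)    ≡⟨ *-assoc 10 (n ^ j) _ ⟨
  10 * n ^ j * (n ∸ suc j) !      ≤⟨ *-monoˡ-≤ ((n ∸ suc j) !) power-ratio ⟩
  11 * falling n j * (n ∸ suc j) ! ≡⟨ *-assoc 11 (falling n j) _ ⟩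
  11 * (falling n j * (n ∸ suc j) !) ≡⟨ cong (11 *_) (factorial-split n j j<n) ⟨
  11 * (n ∸ 1) !                  ∎
  where
    open ≤-Reasoning
    T : ℕ
    T = triangular j
    tenth : 10 * n ≤ 11 * (n ∸ T)
    tenth = subst (10 * n ≤_) (sym (*-distribˡ-∸ 11 n T))
              (m+n≤o⇒m≤o∸n (10 * n) (subst (10 * n + 11 * T ≤_)
                 (solve 1 (λ n → con 10 :* n :+ n := con 11 :* n) refl n) (+-monoʳ-≤ (10 * n) 11T≤n)))
    power-ratio : 10 * n ^ j ≤ 11 * falling n j
    power-ratio = *-cancelʳ-≤ (10 * n ^ j) (11 * falling n j) n (begin
      10 * n ^ j * n             ≡⟨ solve 2 (λ n p → con 10 :* p :* n := p :* (con 10 :* n)) refl n (n ^ j) ⟩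
      n ^ j * (10 * n)           ≤⟨ *-monoʳ-≤ (n ^ j) tenth ⟩
      n ^ j * (11 * (n ∸ T))     ≡⟨ solve 2 (λ p c → p :* (con 11 :* c) := con 11 :* (p :* c)) refl (n ^ j) (n ∸ T) ⟩
      11 * (n ^ j * (n ∸ T))     ≤⟨ *-monoʳ-≤ 11 (power-falling n j) ⟩
      11 * (n * falling n j)     ≡⟨ solve 2 (λ n f → con 11 :* (n :* f) := con 11 :* f :* n) refl n (falling n j) ⟩
      11 * falling n j * n       ∎)

-- Maximum degree of the graph B of non-K_t edges, and maximum order of a non-K_t element.
sparseDegree sparseOrder : ℕ → ℕ
sparseDegree t = 3 * t ∸ 5
sparseOrder  t = 2 * t ∸ 1

-- The numbers of placements of the five configuration types of atypical
-- copies, apart from the powers of n: a cherry and a pair of edges in B, and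
-- a cherry with a vertex, a cherry with an edge and a matching in a K_t.
cherryFactor pairFactor plusFactor cherryEdgeFactor matchingFactor : ℕ → ℕ → ℕ
cherryFactor     d t = d * d * (sparseDegree t * sparseDegree t)
pairFactor       d t = d * d * (sparseDegree t * (sparseOrder t * sparseOrder t))
plusFactor       d t = d * d * (d + (d + d)) * (t * t)
cherryEdgeFactor d t = d * d * d * (t * (t * t))
matchingFactor   d t = d * d * d * (t * (t * (t * t)))

atypicalCount : (d t n : ℕ) → ℕ
atypicalCount d t n =
    cherryFactor d t * pinnedCount n 2
  + (pairFactor d t * pinnedCount n 3
  + (plusFactor d t * pinnedCount n 3
  + (cherryEdgeFactor d t * pinnedCount n 4
  + matchingFactor d t * pinnedCount n 5)))

degree-factors : ∀ d t → 1 ≤ d → 3 ≤ t →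
  cherryFactor d t + (pairFactor d t + (plusFactor d t + (cherryEdgeFactor d t + matchingFactor d t))) ≤
  8 * (d ^ 3 * t ^ 4)
degree-factors d t 1≤d 3≤t = begin
  cherryFactor d t + (pairFactor d t + (plusFactor d t + (cherryEdgeFactor d t + matchingFactor d t)))
    ≤⟨ +-mono-≤ cherry≤ (+-mono-≤ pair≤ (+-mono-≤ plus≤ (+-mono-≤ cherryEdge≤ (≤-reflexive matching≡)))) ⟩
  M + (4 * M + (M + (M + M))) ≡⟨ solve 1 (λ M → M :+ (con 4 :* M :+ (M :+ (M :+ M))) := con 8 :* M) refl M ⟩
  8 * M ∎
  where
    open ≤-Reasoning
    B V M : ℕ
    B = sparseDegree t
    V = sparseOrder t
    M = d ^ 3 * t ^ 4
    B≤ : B ≤ 3 * t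
    B≤ = m∸n≤m (3 * t) 5
    V≤ : V ≤ 2 * t
    V≤ = m∸n≤m (2 * t) 1
    d²≤d³ : d * d ≤ d ^ 3
    d²≤d³ = subst₂ _≤_ (*-identityʳ (d * d)) (solve 1 (λ d → d :* d :* d := d :^ 3) refl d) (*-monoʳ-≤ (d * d) 1≤d)
    triple : ∀ k → 3 * t ^ k ≤ t ^ suc k
    triple k = *-monoˡ-≤ (t ^ k) 3≤t
    grow : ∀ k → t ^ k ≤ t ^ suc k
    grow k = ≤-trans (m≤n*m (t ^ k) 3) (triple k)
    cherry≤ : cherryFactor d t ≤ M
    cherry≤ = *-mono-≤ d²≤d³ (begin
      B * B               ≤⟨ *-mono-≤ B≤ B≤ ⟩
      3 * t * (3 * t)     ≡⟨ solve 1 (λ t → con 3 :* t :* (con 3 :* t) := con 3 :* (con 3 :* t :^ 2)) refl t ⟩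
      3 * (3 * t ^ 2)     ≤⟨ *-monoʳ-≤ 3 (triple 2) ⟩
      3 * t ^ 3           ≤⟨ triple 3 ⟩
      t ^ 4               ∎)
    pair≤ : pairFactor d t ≤ 4 * M
    pair≤ = begin
      d * d * (B * (V * V))         ≤⟨ *-mono-≤ d²≤d³ (*-mono-≤ B≤ (*-mono-≤ V≤ V≤)) ⟩
      d ^ 3 * (3 * t * (2 * t * (2 * t))) ≡⟨ cong (d ^ 3 *_) (solve 1 (λ t → con 3 :* t :* (con 2 :* t :* (con 2 :* t)) := con 4 :* (con 3 :* t :^ 3)) refl t) ⟩
      d ^ 3 * (4 * (3 * t ^ 3))     ≤⟨ *-monoʳ-≤ (d ^ 3) (*-monoʳ-≤ 4 (triple 3)) ⟩
      d ^ 3 * (4 * t ^ 4)           ≡⟨ solve 2 (λ D T → D :* (con 4 :* T) := con 4 :* (D :* T)) refl (d ^ 3) (t ^ 4) ⟩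
      4 * M                         ∎
    plus≤ : plusFactor d t ≤ M
    plus≤ = begin
      d * d * (d + (d + d)) * (t * t) ≡⟨ solve 2 (λ d t → d :* d :* (d :+ (d :+ d)) :* (t :* t) := d :^ 3 :* (con 3 :* t :^ 2)) refl d t ⟩
      d ^ 3 * (3 * t ^ 2)             ≤⟨ *-monoʳ-≤ (d ^ 3) (≤-trans (triple 2) (grow 3)) ⟩
      M                               ∎
    cherryEdge≤ : cherryEdgeFactor d t ≤ M
    cherryEdge≤ = begin
      d * d * d * (t * (t * t)) ≡⟨ solve 2 (λ d t → d :* d :* d :* (t :* (t :* t)) := d :^ 3 :* t :^ 3) refl d t ⟩
      d ^ 3 * t ^ 3             ≤⟨ *-monoʳ-≤ (d ^ 3) (grow 3) ⟩
      M                         ∎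
    matching≡ : matchingFactor d t ≡ M
    matching≡ = solve 2 (λ d t → d :* d :* d :* (t :* (t :* (t :* t))) := d :^ 3 :* t :^ 4) refl d t

-- Since each n^j (n ∸ 1 ∸ j)! is at most 11/10 of (n ∸ 1)! for n ≥ 165, the
-- total is at most 8 · 11/10 · d³t⁴(n ∸ 1)! ≤ 11 d³t⁴(n ∸ 1)!.
atypicalCount-bound : ∀ d t n → 3 ≤ t → 11 * d ^ 3 * t ^ 4 < n →
                      atypicalCount d t n ≤ 11 * d ^ 3 * t ^ 4 * (n ∸ 1) !
atypicalCount-bound zero        t n _   _     = z≤n
atypicalCount-bound d@(suc d′) t n 3≤t large = *-cancelʳ-≤ _ _ 10 (begin
  atypicalCount d t n * 10
    ≡⟨ solve 5 (λ a b c e f → (a :+ (b :+ (c :+ (e :+ f)))) :* con 10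
                := con 10 :* a :+ (con 10 :* b :+ (con 10 :* c :+ (con 10 :* e :+ con 10 :* f))))
             refl (c₁ * Q 2) (c₂ * Q 3) (c₃ * Q 3) (c₄ * Q 4) (c₅ * Q 5) ⟩
  10 * (c₁ * Q 2) + (10 * (c₂ * Q 3) + (10 * (c₃ * Q 3) + (10 * (c₄ * Q 4) + 10 * (c₅ * Q 5))))
    ≤⟨ +-mono-≤ (scale c₁ (q 2 (lit 33) (lit 3)))
        (+-mono-≤ (scale c₂ (q 3 (lit 66) (lit 4)))
        (+-mono-≤ (scale c₃ (q 3 (lit 66) (lit 4)))
        (+-mono-≤ (scale c₄ (q 4 (lit 110) (lit 5))) (scale c₅ (q 5 (lit 165) (lit 6)))))) ⟩
  c₁ * (11 * X) + (c₂ * (11 * X) + (c₃ * (11 * X) + (c₄ * (11 * X) + c₅ * (11 * X))))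
    ≡⟨ solve 6 (λ a b c e f Y → a :* Y :+ (b :* Y :+ (c :* Y :+ (e :* Y :+ f :* Y)))
                := (a :+ (b :+ (c :+ (e :+ f)))) :* Y) refl c₁ c₂ c₃ c₄ c₅ (11 * X) ⟩
  (c₁ + (c₂ + (c₃ + (c₄ + c₅)))) * (11 * X)
    ≤⟨ *-monoˡ-≤ (11 * X) (degree-factors d t (s≤s z≤n) 3≤t) ⟩
  8 * (d ^ 3 * t ^ 4) * (11 * X)
    ≤⟨ subst₂ _≤_ (solve 3 (λ D T X → con 88 :* (D :* T :* X) := con 8 :* (D :* T) :* (con 11 :* X)) refl (d ^ 3) (t ^ 4) X)
                  (solve 3 (λ D T X → con 88 :* (D :* T :* X) :+ con 22 :* (D :* T :* X) := con 11 :* D :* T :* X :* con 10) refl (d ^ 3) (t ^ 4) X)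
                  (m≤m+n _ _) ⟩
  11 * d ^ 3 * t ^ 4 * X * 10 ∎)
  where
    open ≤-Reasoning
    X c₁ c₂ c₃ c₄ c₅ : ℕ
    X  = (n ∸ 1) !
    c₁ = cherryFactor d t
    c₂ = pairFactor d t
    c₃ = plusFactor d t
    c₄ = cherryEdgeFactor d t
    c₅ = matchingFactor d t
    Q : ℕ → ℕ
    Q = pinnedCount n
    -- d ≥ 1 and t ≥ 3 make n exceed 11 · 81 ≥ 165
    165≤n : 165 ≤ n
    165≤n = ≤-trans (m≤m+n 165 726) (≤-trans (≤-trans (*-mono-≤ (*-monoʳ-≤ 11 (^-monoˡ-≤ 3 (s≤s (z≤n {d′})))) (^-monoˡ-≤ 4 3≤t)) (n≤1+n _)) large)
    lit : ∀ a → {a≤165 : True (a ≤? 165)} → a ≤ n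
    lit a {a≤165} = ≤-trans (toWitness a≤165) 165≤n
    q : ∀ j → 11 * triangular j ≤ n → suc j ≤ n → 10 * Q j ≤ 11 * X
    q = power-factorial n
    scale : ∀ c {P} → 10 * P ≤ 11 * X → 10 * (c * P) ≤ c * (11 * X)
    scale c {P} 10P≤ = subst (_≤ c * (11 * X)) (solve 2 (λ c P → c :* (con 10 :* P) := con 10 :* (c :* P)) refl c P)
                             (*-monoʳ-≤ c 10P≤)

same-sym : {n : ℕ} {a b c d : Fin n} → SameEdge a b c d → SameEdge c d a b
same-sym (inj₁ (refl , refl)) = inj₁ (refl , refl)
same-sym (inj₂ (refl , refl)) = inj₂ (refl , refl)

same-trans : {n : ℕ} {a b c d e f : Fin n} → SameEdge a b c d → SameEdge c d e f → SameEdge a b e f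
same-trans (inj₁ (refl , refl)) s                    = s
same-trans (inj₂ (refl , refl)) (inj₁ (refl , refl)) = inj₂ (refl , refl)
same-trans (inj₂ (refl , refl)) (inj₂ (refl , refl)) = inj₁ (refl , refl)

same-swap : {n : ℕ} {a b c d : Fin n} → SameEdge a b c d → SameEdge a b d c
same-swap (inj₁ (a≡c , b≡d)) = inj₂ (a≡c , b≡d)
same-swap (inj₂ (a≡d , b≡c)) = inj₁ (a≡d , b≡c)

triangle-rotate : {n : ℕ} {a₁ b₁ a₂ b₂ a₃ b₃ : Fin n} →
                  FormTriangle a₁ b₁ a₂ b₂ a₃ b₃ → FormTriangle a₂ b₂ a₃ b₃ a₁ b₁
triangle-rotate (x , y , z , x≢y , y≢z , x≢z , e₁ , e₂ , e₃) =
  y , z , x , y≢z , (λ z≡x → x≢z (sym z≡x)) , (λ y≡x → x≢y (sym y≡x)) , e₂ , e₃ , e₁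

triangle-swap : {n : ℕ} {a₁ b₁ a₂ b₂ a₃ b₃ : Fin n} →
                FormTriangle a₁ b₁ a₂ b₂ a₃ b₃ → FormTriangle a₁ b₁ a₃ b₃ a₂ b₂
triangle-swap (x , y , z , x≢y , y≢z , x≢z , e₁ , e₂ , e₃) =
  y , x , z , (λ y≡x → x≢y (sym y≡x)) , x≢z , y≢z , same-swap e₁ , same-swap e₃ , same-swap e₂

triangle-resp : {n : ℕ} {a₁ b₁ a₂ b₂ a₃ b₃ c₁ d₁ c₂ d₂ : Fin n} →
                SameEdge a₁ b₁ c₁ d₁ → SameEdge a₂ b₂ c₂ d₂ →
                FormTriangle c₁ d₁ c₂ d₂ a₃ b₃ → FormTriangle a₁ b₁ a₂ b₂ a₃ b₃
triangle-resp s₁ s₂ (x , y , z , x≢y , y≢z , x≢z , e₁ , e₂ , e₃) =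
  x , y , z , x≢y , y≢z , x≢z , same-trans s₁ e₁ , same-trans s₂ e₂ , e₃

cherry-triangle : {n : ℕ} {a₁ b₁ a₂ b₂ a₃ b₃ x y z : Fin n} → x ≢ y → x ≢ z → y ≢ z →
                  SameEdge a₁ b₁ x y → SameEdge a₂ b₂ x z → SameEdge a₃ b₃ y z →
                  FormTriangle a₁ b₁ a₂ b₂ a₃ b₃
cherry-triangle x≢y x≢z y≢z e₁ e₂ e₃ =
  _ , _ , _ , (λ y≡x → x≢y (sym y≡x)) , x≢z , y≢z , same-swap e₁ , e₂ , same-swap e₃

pair-in-three : {n : ℕ} {a b x y z : Fin n} → a ≢ b → a ∈ x ∷ y ∷ z ∷ [] → b ∈ x ∷ y ∷ z ∷ [] →
                SameEdge a b x y ⊎ SameEdge a b x z ⊎ SameEdge a b y z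
pair-in-three a≢b (here refl)                 (here refl)                 = ⊥-elim (a≢b refl)
pair-in-three _   (here refl)                 (there (here refl))         = inj₁ (inj₁ (refl , refl))
pair-in-three _   (here refl)                 (there (there (here refl))) = inj₂ (inj₁ (inj₁ (refl , refl)))
pair-in-three _   (there (here refl))         (here refl)                 = inj₁ (inj₂ (refl , refl))
pair-in-three a≢b (there (here refl))         (there (here refl))         = ⊥-elim (a≢b refl)
pair-in-three _   (there (here refl))         (there (there (here refl))) = inj₂ (inj₂ (inj₁ (refl , refl)))
pair-in-three _   (there (there (here refl))) (here refl)                 = inj₂ (inj₁ (inj₂ (refl , refl)))
pair-in-three _   (there (there (here refl))) (there (here refl))         = inj₂ (inj₂ (inj₂ (refl , refl)))
pair-in-three a≢b (there (there (here refl))) (there (there (here refl))) = ⊥-elim (a≢b refl)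

module Decomposition {t n m : ℕ} (3≤t : 3 ≤ t) {D : Fin m → Graph n} (adjusted : IsAdjusted t D) where

  private
    decomposition : IsDecomposition D
    decomposition = proj₁ adjusted

  D-sym : ∀ {i a b} → D i a b ≡ true → D i b a ≡ true
  D-sym {i} {a} {b} e = trans (proj₁ (proj₁ decomposition i) b a) e

  D-irrefl : ∀ {i a b} → D i a b ≡ true → a ≢ b
  D-irrefl {i} e refl with () ← trans (sym e) (proj₂ (proj₁ decomposition i) _)

  D-unique : ∀ {i j a b} → D i a b ≡ true → D j a b ≡ true → i ≡ j
  D-unique {i} {j} {a} {b} e₁ e₂ with i ≟F j
  ... | yes i≡j = i≡j
  ... | no  i≢j with () ← trans (sym e₂) (proj₁ (proj₂ decomposition) i j a b i≢j e₁)

  VertexOf : Fin m → Fin n → Set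
  VertexOf i z = Σ (Fin n) λ w → D i z w ≡ true

  Sparse : Fin m → Set
  Sparse i = ¬ IsComplete t (D i)

  SparseEdge : Fin n → Fin n → Set
  SparseEdge a b = Σ (Fin m) λ i → Sparse i × D i a b ≡ true

  NearEdge : (Fin m → Set) → Fin n → Fin n → Fin n → Set
  NearEdge Φ a b z = Σ (Fin m) λ i → Φ i × D i a b ≡ true × VertexOf i z

  atMost-sparseEdge : (a : Fin n) → AtMost (sparseDegree t) (SparseEdge a)
  atMost-sparseEdge = proj₁ (proj₂ adjusted)

  atMost-complete : ∀ {k i} → IsComplete k (D i) → AtMost k (VertexOf i)
  atMost-complete (S , |S|≡k , edges) =
    atMost-mono (atMost-countᵇ S) (λ (w , e) → proj₁ (proj₂ (Equivalence.to (edges _ w) e))) (≤-reflexive |S|≡k)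

  -- A 4-cycle has 4 vertices: each vertex is an endpoint of one of its edges.
  atMost-C4 : ∀ {i} → IsC4 (D i) → AtMost 4 (VertexOf i)
  atMost-C4 {i} (a , b , c , d , _ , edges) = atMost-mono (atMost-∈ corners) corner ≤-refl
    where
      corners : List (Fin n)
      corners = a ∷ b ∷ c ∷ d ∷ []
      endpoint∈ : ∀ {z w p q} → SameEdge z w p q → p ∈ corners → q ∈ corners → z ∈ corners
      endpoint∈ (inj₁ (refl , _)) p∈ _  = p∈
      endpoint∈ (inj₂ (refl , _)) _  q∈ = q∈
      corner : ∀ {z} → VertexOf i z → z ∈ corners
      corner {z} (w , e) with Equivalence.to (edges z w) e
      ... | inj₁ zw≈ab               = endpoint∈ zw≈ab (here refl) (there (here refl))
      ... | inj₂ (inj₁ zw≈bc)        = endpoint∈ zw≈bc (there (here refl)) (there (there (here refl)))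
      ... | inj₂ (inj₂ (inj₁ zw≈cd)) = endpoint∈ zw≈cd (there (there (here refl))) (there (there (there (here refl))))
      ... | inj₂ (inj₂ (inj₂ zw≈da)) = endpoint∈ zw≈da (there (there (there (here refl)))) (here refl)

  5≤sparseOrder : 5 ≤ sparseOrder t
  5≤sparseOrder = m+n≤o⇒m≤o∸n 5 (*-monoʳ-≤ 2 3≤t)

  -- A sparse element (triangle, 4-cycle or K_{2t-1}) has at most 2t ∸ 1 vertices,
  -- as 2t ∸ 1 ≥ 5 for t ≥ 3.
  atMost-sparse : ∀ {i} → Sparse i → AtMost (sparseOrder t) (VertexOf i)
  atMost-sparse {i} sparse with proj₁ (proj₂ (proj₂ adjusted)) i sparse
  ... | inj₁ triangle        = atMost-≤ (≤-trans (m≤m+n 3 2) 5≤sparseOrder) (atMost-complete triangle)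
  ... | inj₂ (inj₁ cycle)    = atMost-≤ (≤-trans (m≤m+n 4 1) 5≤sparseOrder) (atMost-C4 cycle)
  ... | inj₂ (inj₂ complete) = atMost-complete complete

  -- The vertices of the element of kind Φ through a given edge: the element
  -- is unique, so its size bound applies.
  atMost-near : {Φ : Fin m → Set} {s : ℕ} → (∀ {i} → Φ i → AtMost s (VertexOf i)) →
                (a b : Fin n) → AtMost s (NearEdge Φ a b)
  atMost-near bound a b = atMost-inhabited λ (i₀ , φ₀ , e₀ , _) →
    atMost-mono (bound φ₀) (λ {z} (i , _ , e , z∈i) → subst (λ j → VertexOf j z) (D-unique e e₀) z∈i) ≤-refl

module Configurations {t n m : ℕ} (3≤t : 3 ≤ t) {D : Fin m → Graph n} (adjusted : IsAdjusted t D)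
                      (H : Graph n) {d : ℕ} (degH : (v : Fin n) → degree H v ≤ d) where

  open Decomposition 3≤t adjusted

  Clique : Fin m → Set
  Clique i = IsComplete t (D i)

  CliqueNear SparseNear : Fin n → Fin n → Fin n → Set
  CliqueNear = NearEdge Clique
  SparseNear = NearEdge Sparse

  atMost-H : (u : Fin n) → AtMost d (λ v → H u v ≡ true)
  atMost-H u = atMost-≤ (degH u) (atMost-countᵇ (H u))

  atMost-cliqueNear : (a b : Fin n) → AtMost t (CliqueNear a b)
  atMost-cliqueNear = atMost-near atMost-complete

  atMost-sparseNear : (a b : Fin n) → AtMost (sparseOrder t) (SparseNear a b)
  atMost-sparseNear = atMost-near atMost-sparse

  private
    B V : ℕ
    B = sparseDegree t
    V = sparseOrder t

  -- (1) A cherry y – x – z of H placed on two edges ab, ac of B.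
  SparseCherry : Vertices n 6 → Set
  SparseCherry (x , y , z , a , b , c) = H x y ≡ true × H x z ≡ true × SparseEdge a b × SparseEdge a c

  cherryPins : Vertices n 6 → List (Fin n × Fin n)
  cherryPins (x , y , z , a , b , c) = (x , a) ∷ (y , b) ∷ (z , c) ∷ []

  atMost-sparseCherry : AtMost (n * (d * (d * (n * (B * B))))) SparseCherry
  atMost-sparseCherry =
    atMost-Fin× λ x → atMost-Σ _≟F_ (atMost-H x) λ y _ → atMost-Σ _≟F_ (atMost-H x) λ z _ →
    atMost-Fin× λ a → atMost-Σ _≟F_ (atMost-sparseEdge a) λ b _ → atMost-sparseEdge a

  -- (2) An edge uv of H placed on an edge ab of B, and an edge u′v′ of H
  --     placed inside the same sparse element.
  SparsePair : Vertices n 8 → Set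
  SparsePair (u , v , u′ , v′ , a , b , a′ , b′) =
    H u v ≡ true × H u′ v′ ≡ true × SparseEdge a b × SparseNear a b a′ × SparseNear a b b′

  pairPins : Vertices n 8 → List (Fin n × Fin n)
  pairPins (u , v , u′ , v′ , a , b , a′ , b′) = (u , a) ∷ (v , b) ∷ (u′ , a′) ∷ (v′ , b′) ∷ []

  atMost-sparsePair : AtMost (n * (d * (n * (d * (n * (B * (V * V))))))) SparsePair
  atMost-sparsePair =
    atMost-Fin× λ u → atMost-Σ _≟F_ (atMost-H u) λ v _ → atMost-Fin× λ u′ → atMost-Σ _≟F_ (atMost-H u′) λ v′ _ →
    atMost-Fin× λ a → atMost-Σ _≟F_ (atMost-sparseEdge a) λ b _ →
    atMost-Σ _≟F_ (atMost-sparseNear a b) λ a′ _ → atMost-sparseNear a b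

  AdjacentToOne : Fin n → Fin n → Fin n → Fin n → Set
  AdjacentToOne x y z w = H x w ≡ true ⊎ H y w ≡ true ⊎ H z w ≡ true

  -- (3) A cherry y – x – z of H together with a neighbour w of it, placed
  --     inside the K_t element through the image ab of xy.
  CliqueCherryPlus : Vertices n 8 → Set
  CliqueCherryPlus (x , y , z , w , a , b , c , e) =
    H x y ≡ true × H x z ≡ true × AdjacentToOne x y z w × CliqueNear a b c × CliqueNear a b e

  plusPins : Vertices n 8 → List (Fin n × Fin n)
  plusPins (x , y , z , w , a , b , c , e) = (w , e) ∷ (x , a) ∷ (y , b) ∷ (z , c) ∷ []

  atMost-cliqueCherryPlus : AtMost (n * (d * (d * ((d + (d + d)) * (n * (n * (t * t))))))) CliqueCherryPlus
  atMost-cliqueCherryPlus =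
    atMost-Fin× λ x → atMost-Σ _≟F_ (atMost-H x) λ y _ → atMost-Σ _≟F_ (atMost-H x) λ z _ →
    atMost-Σ _≟F_ (atMost-⊎ (atMost-H x) (atMost-⊎ (atMost-H y) (atMost-H z))) λ w _ →
    atMost-Fin× λ a → atMost-Fin× λ b → atMost-Σ _≟F_ (atMost-cliqueNear a b) λ c _ → atMost-cliqueNear a b

  -- (4) A cherry y – x – z and a further edge pq of H, placed inside the K_t
  --     element through the image ab of xy.
  CliqueCherryEdge : Vertices n 10 → Set
  CliqueCherryEdge (x , y , z , p , q , a , b , c , f , g) =
    H x y ≡ true × H x z ≡ true × H p q ≡ true × CliqueNear a b c × CliqueNear a b f × CliqueNear a b g

  cherryEdgePins : Vertices n 10 → List (Fin n × Fin n)
  cherryEdgePins (x , y , z , p , q , a , b , c , f , g) = (q , g) ∷ (p , f) ∷ (x , a) ∷ (y , b) ∷ (z , c) ∷ []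

  atMost-cliqueCherryEdge : AtMost (n * (d * (d * (n * (d * (n * (n * (t * (t * t))))))))) CliqueCherryEdge
  atMost-cliqueCherryEdge =
    atMost-Fin× λ x → atMost-Σ _≟F_ (atMost-H x) λ y _ → atMost-Σ _≟F_ (atMost-H x) λ z _ →
    atMost-Fin× λ p → atMost-Σ _≟F_ (atMost-H p) λ q _ → atMost-Fin× λ a → atMost-Fin× λ b →
    atMost-Σ _≟F_ (atMost-cliqueNear a b) λ c _ → atMost-Σ _≟F_ (atMost-cliqueNear a b) λ f _ → atMost-cliqueNear a b

  -- (5) Three edges of H placed inside the K_t element through the image of the first.
  CliqueMatching : Vertices n 12 → Set
  CliqueMatching (u₁ , v₁ , u₂ , v₂ , u₃ , v₃ , a₁ , b₁ , a₂ , b₂ , a₃ , b₃) =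
    H u₁ v₁ ≡ true × H u₂ v₂ ≡ true × H u₃ v₃ ≡ true ×
    CliqueNear a₁ b₁ a₂ × CliqueNear a₁ b₁ b₂ × CliqueNear a₁ b₁ a₃ × CliqueNear a₁ b₁ b₃

  matchingPins : Vertices n 12 → List (Fin n × Fin n)
  matchingPins (u₁ , v₁ , u₂ , v₂ , u₃ , v₃ , a₁ , b₁ , a₂ , b₂ , a₃ , b₃) =
    (u₁ , a₁) ∷ (v₁ , b₁) ∷ (u₂ , a₂) ∷ (v₂ , b₂) ∷ (u₃ , a₃) ∷ (v₃ , b₃) ∷ []

  atMost-cliqueMatching : AtMost (n * (d * (n * (d * (n * (d * (n * (n * (t * (t * (t * t))))))))))) CliqueMatching
  atMost-cliqueMatching =
    atMost-Fin× λ u₁ → atMost-Σ _≟F_ (atMost-H u₁) λ v₁ _ → atMost-Fin× λ u₂ → atMost-Σ _≟F_ (atMost-H u₂) λ v₂ _ →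
    atMost-Fin× λ u₃ → atMost-Σ _≟F_ (atMost-H u₃) λ v₃ _ → atMost-Fin× λ a₁ → atMost-Fin× λ b₁ →
    atMost-Σ _≟F_ (atMost-cliqueNear a₁ b₁) λ a₂ _ → atMost-Σ _≟F_ (atMost-cliqueNear a₁ b₁) λ b₂ _ →
    atMost-Σ _≟F_ (atMost-cliqueNear a₁ b₁) λ a₃ _ → atMost-cliqueNear a₁ b₁

  AtypicalConfiguration : Vec (Fin n) n → Set
  AtypicalConfiguration σ = Realises SparseCherry cherryPins σ ⊎ Realises SparsePair pairPins σ ⊎
    Realises CliqueCherryPlus plusPins σ ⊎ Realises CliqueCherryEdge cherryEdgePins σ ⊎
    Realises CliqueMatching matchingPins σ

  atMost-atypicalConfiguration : AtMost (atypicalCount d t n) AtypicalConfiguration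
  atMost-atypicalConfiguration =
    atMost-⊎ (realising 3 (λ _ → refl) atMost-sparseCherry
                (solve 4 (λ n d B Y → n :* (d :* (d :* (n :* (B :* B)))) :* Y
                                      := d :* d :* (B :* B) :* (n :^ 2 :* Y)) refl n d B _)) (
    atMost-⊎ (realising 4 (λ _ → refl) atMost-sparsePair
                (solve 5 (λ n d B V Y → n :* (d :* (n :* (d :* (n :* (B :* (V :* V)))))) :* Y
                                        := d :* d :* (B :* (V :* V)) :* (n :^ 3 :* Y)) refl n d B V _)) (
    atMost-⊎ (realising 4 (λ _ → refl) atMost-cliqueCherryPlus
                (solve 4 (λ n d t Y → n :* (d :* (d :* ((d :+ (d :+ d)) :* (n :* (n :* (t :* t)))))) :* Y
                                      := d :* d :* (d :+ (d :+ d)) :* (t :* t) :* (n :^ 3 :* Y)) refl n d t _)) (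
    atMost-⊎ (realising 5 (λ _ → refl) atMost-cliqueCherryEdge
                (solve 4 (λ n d t Y → n :* (d :* (d :* (n :* (d :* (n :* (n :* (t :* (t :* t)))))))) :* Y
                                      := d :* d :* d :* (t :* (t :* t)) :* (n :^ 4 :* Y)) refl n d t _))
             (realising 6 (λ _ → refl) atMost-cliqueMatching
                (solve 4 (λ n d t Y → n :* (d :* (n :* (d :* (n :* (d :* (n :* (n :* (t :* (t :* (t :* t)))))))))) :* Y
                                      := d :* d :* d :* (t :* (t :* (t :* t))) :* (n :^ 5 :* Y)) refl n d t _)))))
    where
      realising : {k K c : ℕ} (j : ℕ) {Shape : Vertices n k → Set} {pins : Vertices n k → List (Fin n × Fin n)} →
                  (∀ w → length (pins w) ≡ j) → AtMost K Shape → K * (n ∸ j) ! ≡ c →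
                  AtMost c (Realises Shape pins)
      realising j length≡ hShape K≡c = atMost-≤ (≤-reflexive K≡c) (atMost-realising j length≡ hShape)

  module Classification (simpleH : IsSimple H) (σ : Vec (Fin n) n) (bijective : IsBijection σ) where

    record CopyEdgeIn (i : Fin m) : Set where
      constructor copyEdge
      field
        u v a b : Fin n
        edgeH   : H u v ≡ true
        σu      : lookup σ u ≡ a
        σv      : lookup σ v ≡ b
        edgeD   : D i a b ≡ true
    open CopyEdgeIn

    reverse : ∀ {i} → CopyEdgeIn i → CopyEdgeIn i
    reverse (copyEdge u v a b uv σu σv ab) = copyEdge v u b a (trans (proj₁ simpleH v u) uv) σv σu (D-sym ab)

    _≈_ : ∀ {i} → CopyEdgeIn i → CopyEdgeIn i → Set
    e ≈ f = SameEdge (a e) (b e) (a f) (b f)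

    preimage-unique : ∀ {u u′ a} → lookup σ u ≡ a → lookup σ u′ ≡ a → u ≡ u′
    preimage-unique σu σu′ = proj₁ bijective _ _ (trans σu (sym σu′))

    data Meeting {i} (e f : CopyEdgeIn i) : Set where
      meet  : (e′ f′ : CopyEdgeIn i) → e ≈ e′ → f ≈ f′ → a e′ ≡ a f′ → Meeting e f
      apart : a e ≢ a f → a e ≢ b f → b e ≢ a f → b e ≢ b f → Meeting e f

    meeting : ∀ {i} (e f : CopyEdgeIn i) → Meeting e f
    meeting e f with a e ≟F a f | a e ≟F b f | b e ≟F a f | b e ≟F b f
    ... | yes ae≡af | _         | _         | _         = meet e f (inj₁ (refl , refl)) (inj₁ (refl , refl)) ae≡af
    ... | no _      | yes ae≡bf | _         | _         = meet e (reverse f) (inj₁ (refl , refl)) (inj₂ (refl , refl)) ae≡bf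
    ... | no _      | no _      | yes be≡af | _         = meet (reverse e) f (inj₂ (refl , refl)) (inj₁ (refl , refl)) be≡af
    ... | no _      | no _      | no _      | yes be≡bf = meet (reverse e) (reverse f) (inj₂ (refl , refl)) (inj₂ (refl , refl)) be≡bf
    ... | no ae≢af  | no ae≢bf  | no be≢af  | no be≢bf  = apart ae≢af ae≢bf be≢af be≢bf

    meet-distinct : ∀ {i} (e f e′ f′ : CopyEdgeIn i) → e ≈ e′ → f ≈ f′ → a e′ ≡ a f′ → ¬ e ≈ f → b e′ ≢ b f′
    meet-distinct _ _ _ _ e≈e′ f≈f′ common e≉f be′≡bf′ =
      e≉f (same-trans e≈e′ (same-trans (inj₁ (common , be′≡bf′)) (same-sym f≈f′)))

    module Cherry {i : Fin m} (e f : CopyEdgeIn i) (common : a e ≡ a f) (y≢z : b e ≢ b f) where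

      edge-xz : D i (a e) (b f) ≡ true
      edge-xz = subst (λ x → D i x (b f) ≡ true) (sym common) (edgeD f)

      H-xz : H (u e) (v f) ≡ true
      H-xz = subst (λ x → H x (v f) ≡ true) (preimage-unique (σu f) (trans (σu e) common)) (edgeH f)

      distinct : Unique (a e ∷ b e ∷ b f ∷ [])
      distinct = (D-irrefl (edgeD e) ∷ D-irrefl edge-xz ∷ []) ∷ (y≢z ∷ []) ∷ [] ∷ []

      fixed : Fix ((u e , a e) ∷ (v e , b e) ∷ (v f , b f) ∷ []) σ
      fixed = σu e ∷ σv e ∷ σv f ∷ []

    sparse-case : ∀ {i} → Sparse i → (e f : CopyEdgeIn i) → ¬ e ≈ f →
                  Realises SparseCherry cherryPins σ ⊎ Realises SparsePair pairPins σ
    sparse-case {i} sparse e f e≉f with meeting e f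
    ... | meet e′ f′ e≈e′ f≈f′ common =
      inj₁ ((u e′ , v e′ , v f′ , a e′ , b e′ , b f′) ,
            (edgeH e′ , H-xz , (i , sparse , edgeD e′) , (i , sparse , edge-xz)) ,
            distinct , bijective , fixed)
      where open Cherry e′ f′ common (meet-distinct e f e′ f′ e≈e′ f≈f′ common e≉f)
    ... | apart ae≢af ae≢bf be≢af be≢bf =
      inj₂ ((u e , v e , u f , v f , a e , b e , a f , b f) ,
            (edgeH e , edgeH f , (i , sparse , edgeD e) ,
             (i , sparse , edgeD e , (b f , edgeD f)) , (i , sparse , edgeD e , (a f , D-sym (edgeD f)))) ,
            (D-irrefl (edgeD e) ∷ ae≢af ∷ ae≢bf ∷ []) ∷ (be≢af ∷ be≢bf ∷ []) ∷ (D-irrefl (edgeD f) ∷ []) ∷ [] ∷ [] ,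
            bijective , σu e ∷ σv e ∷ σu f ∷ σv f ∷ [])

    -- (ii, cherry) A cherry xy, xz in a K_t element and a third copy edge g
    -- in it which is neither xy, xz nor yz: g leaves {x, y, z}.
    module CliqueCherry {i : Fin m} (clique : Clique i) (e f : CopyEdgeIn i) (common : a e ≡ a f) (y≢z : b e ≢ b f) where
      open Cherry e f common y≢z
      open DecMembership (_≟F_ {n}) using (_∈?_)

      xyz : List (Fin n)
      xyz = a e ∷ b e ∷ b f ∷ []

      near : ∀ {c w} → D i c w ≡ true → CliqueNear (a e) (b e) c
      near {w = w} cw = i , clique , edgeD e , (w , cw)

      adjacent : (g : CopyEdgeIn i) → a g ∈ xyz → AdjacentToOne (u e) (v e) (v f) (v g)
      adjacent g (here ag≡x) =
        inj₁ (subst (λ w → H w (v g) ≡ true) (preimage-unique (σu g) (trans (σu e) (sym ag≡x))) (edgeH g))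
      adjacent g (there (here ag≡y)) =
        inj₂ (inj₁ (subst (λ w → H w (v g) ≡ true) (preimage-unique (σu g) (trans (σv e) (sym ag≡y))) (edgeH g)))
      adjacent g (there (there (here ag≡z))) =
        inj₂ (inj₂ (subst (λ w → H w (v g) ≡ true) (preimage-unique (σu g) (trans (σv f) (sym ag≡z))) (edgeH g)))

      -- g has exactly one endpoint outside {x, y, z}: a fourth vertex adjacent to the cherry
      plus : (g : CopyEdgeIn i) → a g ∈ xyz → b g ∉ xyz → Realises CliqueCherryPlus plusPins σ
      plus g ag∈ bg∉ =
        (u e , v e , v f , v g , a e , b e , b f , b g) ,
        (edgeH e , H-xz , adjacent g ag∈ , near (D-sym edge-xz) , near (D-sym (edgeD g))) ,
        ¬Any⇒All¬ xyz bg∉ ∷ distinct , bijective , σv g ∷ fixed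

      -- g avoids {x, y, z}: a cherry and an edge on five vertices
      cherry-edge : (g : CopyEdgeIn i) → a g ∉ xyz → b g ∉ xyz → Realises CliqueCherryEdge cherryEdgePins σ
      cherry-edge g ag∉ bg∉ =
        (u e , v e , v f , u g , v g , a e , b e , b f , a g , b g) ,
        (edgeH e , H-xz , edgeH g , near (D-sym edge-xz) , near (edgeD g) , near (D-sym (edgeD g))) ,
        ((λ bg≡ag → D-irrefl (edgeD g) (sym bg≡ag)) ∷ ¬Any⇒All¬ xyz bg∉) ∷ ¬Any⇒All¬ xyz ag∉ ∷ distinct ,
        bijective , σv g ∷ σu g ∷ fixed

      third-edge : (g : CopyEdgeIn i) → ¬ g ≈ e → ¬ g ≈ f → ¬ FormTriangle (a e) (b e) (a f) (b f) (a g) (b g) →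
                   Realises CliqueCherryPlus plusPins σ ⊎ Realises CliqueCherryEdge cherryEdgePins σ
      third-edge g g≉e g≉f no-triangle with a g ∈? xyz | b g ∈? xyz
      ... | yes ag∈ | yes bg∈ = ⊥-elim (inside (pair-in-three (D-irrefl (edgeD g)) ag∈ bg∈))
        where
          inside : SameEdge (a g) (b g) (a e) (b e) ⊎ SameEdge (a g) (b g) (a e) (b f) ⊎
                   SameEdge (a g) (b g) (b e) (b f) → ⊥
          inside (inj₁ g≈xy)        = g≉e g≈xy
          inside (inj₂ (inj₁ g≈xz)) = g≉f (subst (λ x → SameEdge (a g) (b g) x (b f)) common g≈xz)
          inside (inj₂ (inj₂ g≈yz)) = no-triangle (cherry-triangle (D-irrefl (edgeD e)) (D-irrefl edge-xz) y≢z
                                                     (inj₁ (refl , refl)) (inj₁ (sym common , refl)) g≈yz)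
      ... | yes ag∈ | no bg∉  = inj₁ (plus g ag∈ bg∉)
      ... | no ag∉  | yes bg∈ = inj₁ (plus (reverse g) bg∈ ag∉)
      ... | no ag∉  | no bg∉  = inj₂ (cherry-edge g ag∉ bg∉)

    via-cherry : ∀ {i} → Clique i → {e f : CopyEdgeIn i} (e′ f′ : CopyEdgeIn i) → e ≈ e′ → f ≈ f′ → a e′ ≡ a f′ →
                 ¬ e ≈ f → (g : CopyEdgeIn i) → ¬ g ≈ e → ¬ g ≈ f →
                 ¬ FormTriangle (a e) (b e) (a f) (b f) (a g) (b g) →
                 Realises CliqueCherryPlus plusPins σ ⊎ Realises CliqueCherryEdge cherryEdgePins σ ⊎
                 Realises CliqueMatching matchingPins σ
    via-cherry clique {e} {f} e′ f′ e≈e′ f≈f′ common e≉f g g≉e g≉f no-triangle =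
      map₂ inj₁ (CliqueCherry.third-edge clique e′ f′ common (meet-distinct e f e′ f′ e≈e′ f≈f′ common e≉f) g
                   (λ g≈e′ → g≉e (same-trans g≈e′ (same-sym e≈e′)))
                   (λ g≈f′ → g≉f (same-trans g≈f′ (same-sym f≈f′)))
                   (λ triangle → no-triangle (triangle-resp e≈e′ f≈f′ triangle)))

    -- (ii) Three distinct copy edges in a K_t element, not forming a triangle:
    -- either two of them meet, or they form a matching.
    clique-case : ∀ {i} → Clique i → (e₁ e₂ e₃ : CopyEdgeIn i) → ¬ e₁ ≈ e₂ → ¬ e₁ ≈ e₃ → ¬ e₂ ≈ e₃ →
                  ¬ FormTriangle (a e₁) (b e₁) (a e₂) (b e₂) (a e₃) (b e₃) →
                  Realises CliqueCherryPlus plusPins σ ⊎ Realises CliqueCherryEdge cherryEdgePins σ ⊎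
                  Realises CliqueMatching matchingPins σ
    clique-case {i} clique e₁ e₂ e₃ e₁≉e₂ e₁≉e₃ e₂≉e₃ no-triangle with meeting e₁ e₂
    ... | meet e′ f′ e≈e′ f≈f′ common =
      via-cherry clique {e₁} {e₂} e′ f′ e≈e′ f≈f′ common e₁≉e₂ e₃ (e₁≉e₃ ∘ same-sym) (e₂≉e₃ ∘ same-sym) no-triangle
    ... | apart p₁ p₂ p₃ p₄ with meeting e₁ e₃
    ...   | meet e′ f′ e≈e′ f≈f′ common =
      via-cherry clique {e₁} {e₃} e′ f′ e≈e′ f≈f′ common e₁≉e₃ e₂ (e₁≉e₂ ∘ same-sym) e₂≉e₃ (no-triangle ∘ triangle-swap)
    ...   | apart q₁ q₂ q₃ q₄ with meeting e₂ e₃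
    ...     | meet e′ f′ e≈e′ f≈f′ common =
      via-cherry clique {e₂} {e₃} e′ f′ e≈e′ f≈f′ common e₂≉e₃ e₁ e₁≉e₂ e₁≉e₃ (no-triangle ∘ triangle-rotate ∘ triangle-rotate)
    ...     | apart r₁ r₂ r₃ r₄ = inj₂ (inj₂ (
      (u e₁ , v e₁ , u e₂ , v e₂ , u e₃ , v e₃ , a e₁ , b e₁ , a e₂ , b e₂ , a e₃ , b e₃) ,
      (edgeH e₁ , edgeH e₂ , edgeH e₃ ,
       near (edgeD e₂) , near (D-sym (edgeD e₂)) , near (edgeD e₃) , near (D-sym (edgeD e₃))) ,
      (D-irrefl (edgeD e₁) ∷ p₁ ∷ p₂ ∷ q₁ ∷ q₂ ∷ []) ∷ (p₃ ∷ p₄ ∷ q₃ ∷ q₄ ∷ []) ∷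
      (D-irrefl (edgeD e₂) ∷ r₁ ∷ r₂ ∷ []) ∷ (r₃ ∷ r₄ ∷ []) ∷ (D-irrefl (edgeD e₃) ∷ []) ∷ [] ∷ [] ,
      bijective , σu e₁ ∷ σv e₁ ∷ σu e₂ ∷ σv e₂ ∷ σu e₃ ∷ σv e₃ ∷ []))
      where
        near : ∀ {c w} → D i c w ≡ true → CliqueNear (a e₁) (b e₁) c
        near {w = w} cw = i , clique , edgeD e₁ , (w , cw)

    classify : Atypical t D H σ → AtypicalConfiguration σ
    classify (inj₁ (i , sparse , a₁ , b₁ , a₂ , b₂ , (u₁ , v₁ , uv₁ , σu₁ , σv₁) , (u₂ , v₂ , uv₂ , σu₂ , σv₂) ,
                    e₁≉e₂ , ab₁ , ab₂)) =
      map₂ inj₁ (sparse-case sparse (copyEdge u₁ v₁ a₁ b₁ uv₁ σu₁ σv₁ ab₁) (copyEdge u₂ v₂ a₂ b₂ uv₂ σu₂ σv₂ ab₂) e₁≉e₂)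
    classify (inj₂ (i , clique , a₁ , b₁ , a₂ , b₂ , a₃ , b₃ ,
                    (u₁ , v₁ , uv₁ , σu₁ , σv₁) , (u₂ , v₂ , uv₂ , σu₂ , σv₂) , (u₃ , v₃ , uv₃ , σu₃ , σv₃) ,
                    ab₁ , ab₂ , ab₃ , e₁≉e₂ , e₁≉e₃ , e₂≉e₃ , no-triangle)) =
      inj₂ (inj₂ (clique-case clique (copyEdge u₁ v₁ a₁ b₁ uv₁ σu₁ σv₁ ab₁) (copyEdge u₂ v₂ a₂ b₂ uv₂ σu₂ σv₂ ab₂)
                    (copyEdge u₃ v₃ a₃ b₃ uv₃ σu₃ σv₃ ab₃) e₁≉e₂ e₁≉e₃ e₂≉e₃ no-triangle))

  atMost-atypical : IsSimple H → AtMost (atypicalCount d t n) (λ σ → IsBijection σ × Atypical t D H σ)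
  atMost-atypical simpleH =
    atMost-mono atMost-atypicalConfiguration (λ {σ} (bijective , atypical) → Classification.classify simpleH σ bijective atypical) ≤-refl

-- For n ≤ 11 d³t⁴ count all n! = n (n ∸ 1)! bijections (n is odd, so n ≥ 1);
-- otherwise classify the atypical copies and apply the arithmetic estimate.
lemma2p6 : (t n : ℕ) → Odd t → 3 ≤ t → Odd n →
           (m : ℕ) (D : Fin m → Graph n) → IsAdjusted t D →
           (H : Graph n) → IsSimple H → (d : ℕ) → MaxDegree H d →
           AtMost (11 * d ^ 3 * t ^ 4 * (n ∸ 1) !)
             (λ (σ : Vec (Fin n) n) → IsBijection σ × Atypical t D H σ)
lemma2p6 t n _ 3≤t (k , refl) m D adjusted H simpleH d (degH , _) with n ≤? 11 * d ^ 3 * t ^ 4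
... | yes small = atMost-≤ (*-monoˡ-≤ ((n ∸ 1) !) small)
                    (atMost-mono (atMost-bijections-fixing [] []) (λ (bijective , _) → bijective , []) ≤-refl)
... | no large  = atMost-≤ (atypicalCount-bound d t n 3≤t (≰⇒> large))
                    (Configurations.atMost-atypical 3≤t adjusted H degH simpleH)
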